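{- Let $G=(V,E)$ be a connected graph of order $n$ and let $S$ be an LD-set of $G$ with exactly $k$ vertices. Let $G^{S}$ be the $S$-associated graph. Then: 1. $|V(G^{S})|=n-k+1$. 2. $G^{S}$ is bipartite. 3. Any two distinct edges of $G^S$ sharing an endpoint have different labels. 4. For every $v\in S$, every cycle of $G^{S}$ contains an even number of edges labeled $v$. 5. If $\rho$ is a walk in $G^{S}$ with no repeated edges such that, for every $v\in S$, $\rho$ contains an even number of edges labeled $v$, then $\rho$ is a closed walk. 6. If $\rho=x_ix_{i+1}\dots x_{i+h}$ is a path in $G^S$ such that, for every $j\in\{0,1,\dots,h\}$, the vertex $x_{i+j}$ lies at level $i+j$, then (a) the edges of $\rho$ have pairwise different labels; and (b) for every $j\in\{i+1,\dots,i+h\}$ and every $m\in\{i,i+1,\dots,j-1\}$, the set $N_G(x_j)\cap S$ contains the vertex $\ell(x_mx_{m+1})$.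
   Context: All graphs are simple and finite; $N_G(v)$ is the open neighborhood of $v$, and $A\bigtriangleup B=(A\setminus B)\cup(B\setminus A)$. A set $S\subseteq V$ is a locating-dominating set (LD-set) of $G$ if every vertex of $V\setminus S$ has a neighbor in $S$ and for any two distinct $u,v\in V\setminus S$, $N_G(u)\cap S\neq N_G(v)\cap S$. The $S$-associated graph $G^S$: take a new vertex $z\notin V$ and set $N_G(z)=\emptyset$; $G^S$ is the edge-labeled graph with vertex set $(V\setminus S)\cup\{z\}$, in which two vertices $x,y$ are adjacent iff $|(N_G(x)\cap S)\bigtriangleup(N_G(y)\cap S)|=1$, and the label $\ell(xy)\in S$ of such an edge is the unique element of $(N_G(x)\cap S)\bigtriangleup(N_G(y)\cap S)$. The level of a vertex $x$ of $G^S$ is $|N_G(x)\cap S|$ (so $z$ is at level $0$). -}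

module Defs where

open import Data.Nat using (ℕ; zero; suc; _+_; _≤_)
open import Data.Nat.Divisibility using (_∣_)
open import Data.Bool using (Bool; true; false; _xor_)
open import Data.Bool.Properties using () renaming (_≟_ to _≟ᵇ_)
open import Data.Fin using (Fin; suc; inject₁; toℕ)
open import Data.Fin.Subset using (Subset; _∈_; _∉_; _∩_; ⊥; ⁅_⁆; ∣_∣; outside)
open import Data.Vec using (Vec; tabulate; lookup; zipWith)
open import Data.Vec.Properties using (≡-dec)
open import Data.Maybe using (Maybe; just; nothing)
open import Data.List using (List; []; _∷_)
open import Data.Product using (Σ; ∃; _×_; _,_)
open import Data.Sum using (_⊎_)
open import Data.Empty using () renaming (⊥ to Empty)
open import Relation.Nullary using (¬_; does)
open import Relation.Binary.PropositionalEquality using (_≡_; _≢_)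
open import Data.List.Relation.Unary.Linked using (Linked)

record Graph (n : ℕ) : Set where
  field
    E     : Fin n → Fin n → Bool
    sym   : ∀ u v → E u v ≡ E v u
    irrefl : ∀ v → E v v ≡ false

module _ {n : ℕ} (G : Graph n) where
  open Graph G

  N : Fin n → Subset n
  N v = tabulate (E v)

  endG : Fin n → List (Fin n) → Fin n
  endG x [] = x
  endG x (y ∷ ys) = endG y ys

  Connected : Set
  Connected = ∀ u v → ∃ λ (xs : List (Fin n)) →
                Linked (λ a b → E a b ≡ true) (u ∷ xs) × endG u xs ≡ v

  IsLD : Subset n → Set
  IsLD S = (∀ u → u ∉ S → ∃ λ s → s ∈ S × E u s ≡ true)
         × (∀ u w → u ∉ S → w ∉ S → u ≢ w → (N u ∩ S) ≢ (N w ∩ S))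

_Δ_ : ∀ {n} → Subset n → Subset n → Subset n
_Δ_ = zipWith _xor_

module Assoc {n : ℕ} (G : Graph n) (S : Subset n) where

  -- Vertices of G^S: nothing is the new vertex z, just (v , _) is a
  -- vertex v ∈ V ∖ S.
  VS : Set
  VS = Maybe (Σ (Fin n) (λ v → lookup S v ≡ outside))

  tr : VS → Subset n
  tr nothing = ⊥
  tr (just (v , _)) = N G v ∩ S

  level : VS → ℕ
  level x = ∣ tr x ∣

  Adj : VS → VS → Set
  Adj x y = ∣ tr x Δ tr y ∣ ≡ 1

  Label : VS → VS → Fin n → Set
  Label x y v = (tr x Δ tr y) ≡ ⁅ v ⁆

  Bipartite : Set
  Bipartite = Σ (VS → Bool) λ c → ∀ x y → Adj x y → c x ≢ c y

  end : VS → List VS → VS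
  end x [] = x
  end x (y ∷ ys) = end y ys

  steps : VS → List VS → List (VS × VS)
  steps x [] = []
  steps x (y ∷ ys) = (x , y) ∷ steps y ys

  labCount : Fin n → List (VS × VS) → ℕ
  labCount v [] = 0
  labCount v ((a , b) ∷ ps) with does (≡-dec _≟ᵇ_ (tr a Δ tr b) ⁅ v ⁆)
  ... | true  = suc (labCount v ps)
  ... | false = labCount v ps

  SameEdge : VS × VS → VS × VS → Set
  SameEdge (a , b) (c , d) = (a ≡ c × b ≡ d) ⊎ (a ≡ d × b ≡ c)

module Submission where

-- Every vertex x of G^S is recorded by its trace tr x = N_G(x) ∩ S, and
-- an edge xy of G^S with label v means  tr x Δ tr y = {v}.  Everything
-- follows from three facts about traces:
--   * tr is injective (S is locating, and dominating so that no vertex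
--     outside S has the empty trace of z), and tr x ⊆ S;
--   * along an edge the trace changes by toggling the single label, so
--     the level changes by exactly one and (Boolean telescoping) for any
--     walk and any v, "v ∈ tr(start) xor v ∈ tr(end)" is the parity of
--     the number of edges labeled v;
--   * along an edge going up one level the label is added to the trace,
--     so traces increase along an ascending path.

open import Defs
open import Data.Nat using (ℕ; zero; suc; pred; _+_; _*_; _∸_; _≤_; _<_; z≤n; s≤s)
open import Data.Nat.Properties using (+-suc; +-comm; <-cmp; m+1+n≢n)
open import Data.Nat.Divisibility using (_∣_; divides; _∣0; ∣-refl; ∣m∣n⇒∣m+n)
open import Data.Bool using (Bool; true; false; not; _xor_)
open import Data.Bool.Properties
  using (not-involutive; not-¬; xor-same; xor-assoc; xor-identityˡ; xor-identityʳ)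
  renaming (_≟_ to _≟ᵇ_)
open import Data.Fin using (Fin; zero; suc; inject₁; toℕ; _≟_)
open import Data.Fin.Properties using (toℕ-inject₁; toℕ-injective)
open import Data.Fin.Subset
  using (Subset; _∈_; _∉_; _⊆_; _∩_; ⊥; ⁅_⁆; ∁; ∣_∣; inside; outside)
open import Data.Fin.Subset.Properties
  using (⊆-refl; ⊆-trans; ⊆-min; x∈⁅x⁆; ∉⊥; x∈p∩q⁺; p∩q⊆q; ∣∁p∣≡n∸∣p∣)
open import Data.Vec using ([]; _∷_; lookup)
open import Data.Vec.Properties
  using (lookup-zipWith; lookup-replicate; lookup∘tabulate; tabulate∘lookup;
         tabulate-cong; map-id; lookup⇒[]=; []=⇒lookup; ≡-dec;
         zipWith-assoc; zipWith-identityˡ; zipWith-identityʳ; zipWith-inverseˡ)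
open import Data.Maybe using (Maybe; just; nothing)
open import Data.List using (List; []; _∷_; length)
open import Data.List.Relation.Unary.Linked using (Linked; _∷_)
open import Data.List.Relation.Unary.AllPairs using (AllPairs)
open import Data.List.Relation.Unary.Unique.Propositional using (Unique)
open import Data.Product using (Σ; ∃; _×_; _,_; proj₁; proj₂)
open import Data.Sum using (_⊎_; inj₁; inj₂)
open import Data.Empty using () renaming (⊥-elim to absurd)
open import Function using (id; _∘_; flip)
open import Function.Bundles using (_↔_; Inverse; mk↔ₛ′)
open import Function.Properties.Inverse using (↔-trans)
open import Relation.Binary using (Rel; Reflexive; Transitive; tri<; tri≈; tri>)
open import Relation.Binary.PropositionalEquality
  using (_≡_; _≢_; refl; sym; trans; cong; cong₂; subst; module ≡-Reasoning)
open import Relation.Nullary using (¬_; yes; no; does)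
open import Relation.Nullary.Decidable using (dec-true; dec-false)
open import Axiom.UniquenessOfIdentityProofs using (module Decidable⇒UIP)

open ≡-Reasoning

xor-telescope : ∀ a b c → (a xor b) xor (b xor c) ≡ a xor c
xor-telescope false false c = refl
xor-telescope false true  c = not-involutive c
xor-telescope true  false c = refl
xor-telescope true  true  c = refl

xor≡false⇒≡ : ∀ a b → a xor b ≡ false → a ≡ b
xor≡false⇒≡ false false _ = refl
xor≡false⇒≡ true  true  _ = refl
xor≡false⇒≡ false true  ()
xor≡false⇒≡ true  false ()

odd : ℕ → Bool
odd zero          = false
odd (suc zero)    = true
odd (suc (suc m)) = odd m

odd-suc : ∀ m → odd (suc m) ≡ not (odd m)
odd-suc zero          = refl
odd-suc (suc zero)    = refl
odd-suc (suc (suc m)) = odd-suc m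

even⇒¬odd : ∀ {m} → 2 ∣ m → odd m ≡ false
even⇒¬odd (divides q refl) = odd-double q
  where
  odd-double : ∀ q → odd (q * 2) ≡ false
  odd-double zero    = refl
  odd-double (suc q) = odd-double q

¬odd⇒even : ∀ m → odd m ≡ false → 2 ∣ m
¬odd⇒even zero          _  = 2 ∣0
¬odd⇒even (suc zero)    ()
¬odd⇒even (suc (suc m)) ev = ∣m∣n⇒∣m+n (∣-refl {2}) (¬odd⇒even m ev)

lookup-Δ : ∀ {m} (A B : Subset m) i → lookup (A Δ B) i ≡ lookup A i xor lookup B i
lookup-Δ A B i = lookup-zipWith _xor_ i A B

lookup-injective : ∀ {m} (A B : Subset m) → (∀ i → lookup A i ≡ lookup B i) → A ≡ B
lookup-injective A B same =
  trans (sym (tabulate∘lookup A)) (trans (tabulate-cong same) (tabulate∘lookup B))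

lookup-⁅⁆ : ∀ {m} (v w : Fin m) → lookup ⁅ v ⁆ w ≡ does (v ≟ w)
lookup-⁅⁆ zero    zero    = refl
lookup-⁅⁆ zero    (suc w) = lookup-replicate w outside
lookup-⁅⁆ (suc v) zero    = refl
lookup-⁅⁆ (suc v) (suc w) = lookup-⁅⁆ v w

∉⇒outside : ∀ {m} {A : Subset m} {v} → v ∉ A → lookup A v ≡ outside
∉⇒outside {A = A} {v} v∉A with lookup A v in eq
... | outside = refl
... | inside  = absurd (v∉A (lookup⇒[]= v A eq))

outside⇒∉ : ∀ {m} {A : Subset m} {v} → lookup A v ≡ outside → v ∉ A
outside⇒∉ eq v∈A with trans (sym ([]=⇒lookup v∈A)) eq
... | ()

Δ-identityʳ : ∀ {m} (A : Subset m) → A Δ ⊥ ≡ A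
Δ-identityʳ = zipWith-identityʳ xor-identityʳ

Δ-self : ∀ {m} (A : Subset m) → A Δ A ≡ ⊥
Δ-self A = trans (cong (_Δ A) (sym (map-id A))) (zipWith-inverseˡ {⁻¹ = id} xor-same A)

-- Δ is a group operation in which every element is its own inverse, so
-- an equation A Δ B = C can be solved for B.
Δ-cancelˡ : ∀ {m} (A B C : Subset m) → A Δ B ≡ C → B ≡ A Δ C
Δ-cancelˡ A B C AΔB≡C = begin
  B            ≡⟨ zipWith-identityˡ xor-identityˡ B ⟨
  ⊥ Δ B        ≡⟨ cong (_Δ B) (Δ-self A) ⟨
  (A Δ A) Δ B  ≡⟨ zipWith-assoc xor-assoc A A B ⟩
  A Δ (A Δ B)  ≡⟨ cong (A Δ_) AΔB≡C ⟩
  A Δ C        ∎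

size-zero⇒empty : ∀ {m} (D : Subset m) → ∣ D ∣ ≡ 0 → D ≡ ⊥
size-zero⇒empty []             _  = refl
size-zero⇒empty (outside ∷ D) eq = cong (outside ∷_) (size-zero⇒empty D eq)
size-zero⇒empty (inside ∷ D)  ()

size-one⇒singleton : ∀ {m} (D : Subset m) → ∣ D ∣ ≡ 1 → ∃ λ v → D ≡ ⁅ v ⁆
size-one⇒singleton []            ()
size-one⇒singleton (inside ∷ D)  eq = zero , cong (inside ∷_) (size-zero⇒empty D (cong pred eq))
size-one⇒singleton (outside ∷ D) eq with size-one⇒singleton D eq
... | v , D≡⁅v⁆ = suc v , cong (outside ∷_) D≡⁅v⁆

size-one-lookup : ∀ {m} (D : Subset m) {v} → ∣ D ∣ ≡ 1 → D ≢ ⁅ v ⁆ → lookup D v ≡ outside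
size-one-lookup D {v} size1 D≢⁅v⁆ with size-one⇒singleton D size1
... | u , refl = trans (lookup-⁅⁆ u v) (dec-false (u ≟ v) (D≢⁅v⁆ ∘ cong ⁅_⁆))

toggle-size-out : ∀ {m} (A : Subset m) v → lookup A v ≡ outside → ∣ A Δ ⁅ v ⁆ ∣ ≡ suc ∣ A ∣
toggle-size-out (outside ∷ A) zero    _  = cong (suc ∘ ∣_∣) (Δ-identityʳ A)
toggle-size-out (inside ∷ A)  zero    ()
toggle-size-out (outside ∷ A) (suc v) eq = toggle-size-out A v eq
toggle-size-out (inside ∷ A)  (suc v) eq = cong suc (toggle-size-out A v eq)

toggle-size-in : ∀ {m} (A : Subset m) v → lookup A v ≡ inside → ∣ A ∣ ≡ suc ∣ A Δ ⁅ v ⁆ ∣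
toggle-size-in (inside ∷ A)  zero    _  = cong (suc ∘ ∣_∣) (sym (Δ-identityʳ A))
toggle-size-in (outside ∷ A) zero    ()
toggle-size-in (outside ∷ A) (suc v) eq = toggle-size-in A v eq
toggle-size-in (inside ∷ A)  (suc v) eq = cong suc (toggle-size-in A v eq)

unit-difference-size : ∀ {m} (A B : Subset m) → ∣ A Δ B ∣ ≡ 1 →
                       ∣ B ∣ ≡ suc ∣ A ∣ ⊎ ∣ A ∣ ≡ suc ∣ B ∣
unit-difference-size A B size1 with size-one⇒singleton (A Δ B) size1
... | v , AΔB≡⁅v⁆ with Δ-cancelˡ A B _ AΔB≡⁅v⁆ | lookup A v in v∈?A
... | refl | outside = inj₁ (toggle-size-out A v v∈?A)
... | refl | inside  = inj₂ (toggle-size-in A v v∈?A)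

toggle-grows : ∀ {m} (A : Subset m) v → v ∉ A → v ∈ A Δ ⁅ v ⁆ × A ⊆ A Δ ⁅ v ⁆
toggle-grows A v v∉A = lookup⇒[]= v _ v-added , λ {w} w∈A → lookup⇒[]= w _ (w-kept w∈A)
  where
  toggled : ∀ w → lookup (A Δ ⁅ v ⁆) w ≡ lookup A w xor does (v ≟ w)
  toggled w = trans (lookup-Δ A ⁅ v ⁆ w) (cong (lookup A w xor_) (lookup-⁅⁆ v w))

  v-added : lookup (A Δ ⁅ v ⁆) v ≡ inside
  v-added = trans (toggled v) (cong₂ _xor_ (∉⇒outside v∉A) (dec-true (v ≟ v) refl))

  w-kept : ∀ {w} → w ∈ A → lookup (A Δ ⁅ v ⁆) w ≡ inside
  w-kept {w} w∈A = trans (toggled w)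
    (cong₂ _xor_ ([]=⇒lookup w∈A) (dec-false (v ≟ w) λ { refl → v∉A w∈A }))

Outside : ∀ {m} → Subset m → Set
Outside {m} T = Σ (Fin m) λ v → lookup T v ≡ outside

Maybe↔Fin-suc : ∀ {A : Set} {r} → A ↔ Fin r → Maybe A ↔ Fin (suc r)
Maybe↔Fin-suc {A} {r} A↔Fin = mk↔ₛ′ to from to∘from from∘to
  where
  open Inverse A↔Fin renaming (to to toA; from to fromA)

  to : Maybe A → Fin (suc r)
  to nothing  = zero
  to (just a) = suc (toA a)

  from : Fin (suc r) → Maybe A
  from zero    = nothing
  from (suc i) = just (fromA i)

  to∘from : ∀ i → to (from i) ≡ i
  to∘from zero    = refl
  to∘from (suc i) = cong suc (strictlyInverseˡ i)

  from∘to : ∀ a → from (to a) ≡ a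
  from∘to nothing  = refl
  from∘to (just a) = cong just (strictlyInverseʳ a)

outside-∷-inside : ∀ {m} {T : Subset m} → Outside (inside ∷ T) ↔ Outside T
outside-∷-inside {T = T} = mk↔ₛ′ to from (λ _ → refl) from∘to
  where
  to : Outside (inside ∷ T) → Outside T
  to (zero  , ())
  to (suc v , v∉) = v , v∉

  from : Outside T → Outside (inside ∷ T)
  from (v , v∉) = suc v , v∉

  from∘to : ∀ a → from (to a) ≡ a
  from∘to (zero  , ())
  from∘to (suc v , v∉) = refl

outside-∷-outside : ∀ {m} {T : Subset m} → Outside (outside ∷ T) ↔ Maybe (Outside T)
outside-∷-outside {T = T} = mk↔ₛ′ to from to∘from from∘to
  where
  to : Outside (outside ∷ T) → Maybe (Outside T)
  to (zero  , _)  = nothing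
  to (suc v , v∉) = just (v , v∉)

  from : Maybe (Outside T) → Outside (outside ∷ T)
  from nothing         = zero , refl
  from (just (v , v∉)) = suc v , v∉

  to∘from : ∀ b → to (from b) ≡ b
  to∘from nothing  = refl
  to∘from (just _) = refl

  from∘to : ∀ a → from (to a) ≡ a
  from∘to (zero  , p) = cong (zero ,_) (Decidable⇒UIP.≡-irrelevant _≟ᵇ_ refl p)
  from∘to (suc v , _) = refl

outside↔ : ∀ {m} (T : Subset m) → Outside T ↔ Fin ∣ ∁ T ∣
outside↔ []            = mk↔ₛ′ (λ { (() , _) }) (λ ()) (λ ()) (λ { (() , _) })
outside↔ (inside ∷ T)  = ↔-trans outside-∷-inside (outside↔ T)
outside↔ (outside ∷ T) = ↔-trans outside-∷-outside (Maybe↔Fin-suc (outside↔ T))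

module _ {a ℓ} {A : Set a} {_∼_ : Rel A ℓ}
         (∼-refl : Reflexive _∼_) (∼-trans : Transitive _∼_) where

  chain-mono : ∀ {h} (T : Fin (suc h) → A) → (∀ j → T (inject₁ j) ∼ T (suc j)) →
               ∀ a b → toℕ a ≤ toℕ b → T a ∼ T b
  chain-mono T step zero zero _ = ∼-refl
  chain-mono {suc h} T step zero (suc b) _ =
    ∼-trans (step zero) (chain-mono (T ∘ suc) (step ∘ suc) zero b z≤n)
  chain-mono {suc h} T step (suc a) (suc b) (s≤s a≤b) =
    chain-mono (T ∘ suc) (step ∘ suc) a b a≤b

-- Part 1 holds for every S: the vertices of G^S are z and the points
-- outside S.
associated-order : ∀ {n} (G : Graph n) (S : Subset n) →
                   Assoc.VS G S ↔ Fin (n ∸ ∣ S ∣ + 1)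
associated-order {n} G S =
  subst (λ r → Assoc.VS G S ↔ Fin r) size (Maybe↔Fin-suc (outside↔ S))
  where
  size : suc ∣ ∁ S ∣ ≡ n ∸ ∣ S ∣ + 1
  size = trans (cong suc (∣∁p∣≡n∸∣p∣ S)) (+-comm 1 (n ∸ ∣ S ∣))

module LocatingDominating {n} (G : Graph n) (S : Subset n) (ld : IsLD G S) where
  open Assoc G S
  open Graph G using (E)

  trace⊆S : ∀ x → tr x ⊆ S
  trace⊆S nothing        = ⊆-min S
  trace⊆S (just (u , _)) = p∩q⊆q (N G u) S

  trace-nonempty : ∀ u → u ∉ S → N G u ∩ S ≢ ⊥
  trace-nonempty u u∉S N∩S≡⊥ with proj₁ ld u u∉S
  ... | s , s∈S , Eus = ∉⊥ (subst (s ∈_) N∩S≡⊥ (x∈p∩q⁺ (s∈N , s∈S)))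
    where
    s∈N : s ∈ N G u
    s∈N = lookup⇒[]= s (N G u) (trans (lookup∘tabulate (E u) s) Eus)

  trace-injective : ∀ x y → tr x ≡ tr y → x ≡ y
  trace-injective nothing        nothing        _  = refl
  trace-injective nothing        (just (u , p)) eq = absurd (trace-nonempty u (outside⇒∉ p) (sym eq))
  trace-injective (just (u , p)) nothing        eq = absurd (trace-nonempty u (outside⇒∉ p) eq)
  trace-injective (just (u , p)) (just (w , q)) eq with u ≟ w
  ... | yes refl = cong (λ r → just (u , r)) (Decidable⇒UIP.≡-irrelevant _≟ᵇ_ p q)
  ... | no  u≢w  = absurd (proj₂ ld u w (outside⇒∉ p) (outside⇒∉ q) u≢w eq)

  -- Part 3: from x, the label of an edge determines its other end.
  distinct-labels-at-vertex : ∀ x y w → Adj x y → Adj x w → y ≢ w →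
                              ∀ v → Label x y v → ¬ Label x w v
  distinct-labels-at-vertex x y w _ _ y≢w v xy-v xw-v =
    y≢w (trace-injective y w (trans (Δ-cancelˡ (tr x) (tr y) _ xy-v)
                                    (sym (Δ-cancelˡ (tr x) (tr w) _ xw-v))))

  -- Part 2: adjacent vertices lie on consecutive levels, so the parity
  -- of the level is a proper 2-colouring.
  bipartite : Bipartite
  bipartite = odd ∘ level , proper
    where
    proper : ∀ x y → Adj x y → odd (level x) ≢ odd (level y)
    proper x y xy with unit-difference-size (tr x) (tr y) xy
    ... | inj₁ up   = λ same → not-¬ refl (trans same (trans (cong odd up) (odd-suc (level x))))
    ... | inj₂ down = λ same → not-¬ refl (trans (sym same) (trans (cong odd down) (odd-suc (level y))))

  labCount-cons : ∀ a b → Adj a b → ∀ v ps →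
    odd (labCount v ((a , b) ∷ ps)) ≡ lookup (tr a Δ tr b) v xor odd (labCount v ps)
  labCount-cons a b ab v ps with ≡-dec _≟ᵇ_ (tr a Δ tr b) ⁅ v ⁆
  ... | yes ab-v = trans (odd-suc (labCount v ps))
          (cong (_xor odd (labCount v ps))
                (sym (trans (cong (λ D → lookup D v) ab-v) ([]=⇒lookup (x∈⁅x⁆ v)))))
  ... | no ¬ab-v = cong (_xor odd (labCount v ps)) (sym (size-one-lookup (tr a Δ tr b) ab ¬ab-v))

  walk-parity : ∀ x xs → Linked Adj (x ∷ xs) → ∀ v →
    lookup (tr x) v xor lookup (tr (end x xs)) v ≡ odd (labCount v (steps x xs))
  walk-parity x []       _           v = xor-same (lookup (tr x) v)
  walk-parity x (y ∷ ys) (xy ∷ walk) v = begin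
    lookup (tr x) v xor lookup (tr (end y ys)) v
      ≡⟨ xor-telescope (lookup (tr x) v) (lookup (tr y) v) (lookup (tr (end y ys)) v) ⟨
    (lookup (tr x) v xor lookup (tr y) v) xor (lookup (tr y) v xor lookup (tr (end y ys)) v)
      ≡⟨ cong₂ _xor_ (sym (lookup-Δ (tr x) (tr y) v)) (walk-parity y ys walk v) ⟩
    lookup (tr x Δ tr y) v xor odd (labCount v (steps y ys))
      ≡⟨ labCount-cons x y xy v (steps y ys) ⟨
    odd (labCount v (steps x (y ∷ ys)))
      ∎

  closed-walk-even : ∀ x xs → Linked Adj (x ∷ xs) → end x xs ≡ x →
                     ∀ v → 2 ∣ labCount v (steps x xs)
  closed-walk-even x xs walk closed v = ¬odd⇒even _ (begin
    odd (labCount v (steps x xs))                  ≡⟨ walk-parity x xs walk v ⟨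
    lookup (tr x) v xor lookup (tr (end x xs)) v  ≡⟨ cong (λ y → lookup (tr x) v xor lookup (tr y) v) closed ⟩
    lookup (tr x) v xor lookup (tr x) v           ≡⟨ xor-same (lookup (tr x) v) ⟩
    false                                          ∎)

  -- Part 5 (for every walk): the ends have the same trace, hence are equal.
  even-walk-closed : ∀ x xs → Linked Adj (x ∷ xs) →
                     (∀ v → v ∈ S → 2 ∣ labCount v (steps x xs)) → end x xs ≡ x
  even-walk-closed x xs walk even =
    sym (trace-injective x (end x xs) (lookup-injective _ _ same-trace))
    where
    outside-S : ∀ {w} y → lookup S w ≡ outside → lookup (tr y) w ≡ outside
    outside-S y w∉S = ∉⇒outside (outside⇒∉ w∉S ∘ trace⊆S y)

    same-trace : ∀ w → lookup (tr x) w ≡ lookup (tr (end x xs)) w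
    same-trace w with lookup S w in w∈?S
    ... | inside  = xor≡false⇒≡ _ _
          (trans (walk-parity x xs walk w) (even⇒¬odd (even w (lookup⇒[]= w S w∈?S))))
    ... | outside = trans (outside-S x w∈?S) (sym (outside-S (end x xs) w∈?S))

  ascend : ∀ a b v → Label a b v → level b ≡ suc (level a) →
           v ∉ tr a × v ∈ tr b × tr a ⊆ tr b
  ascend a b v ab-v up with lookup (tr a) v in v∈?a
  ... | outside = v∉a , subst (λ T → v ∈ T × tr a ⊆ T) (sym tr-b) (toggle-grows (tr a) v v∉a)
    where
    v∉a  = outside⇒∉ v∈?a
    tr-b = Δ-cancelˡ (tr a) (tr b) _ ab-v
  ... | inside = absurd (m+1+n≢n 1 (sym (begin
    level a                   ≡⟨ toggle-size-in (tr a) v v∈?a ⟩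
    suc ∣ tr a Δ ⁅ v ⁆ ∣     ≡⟨ cong (suc ∘ ∣_∣) (Δ-cancelˡ (tr a) (tr b) _ ab-v) ⟨
    suc (level b)             ≡⟨ cong suc up ⟩
    suc (suc (level a))       ∎)))

  module AscendingPath (i h : ℕ) (p : Fin (suc h) → VS)
         (adj : ∀ (j : Fin h) → Adj (p (inject₁ j)) (p (suc j)))
         (lev : ∀ j → level (p j) ≡ i + toℕ j) where

    rises : ∀ j → level (p (suc j)) ≡ suc (level (p (inject₁ j)))
    rises j = begin
      level (p (suc j))             ≡⟨ lev (suc j) ⟩
      i + suc (toℕ j)               ≡⟨ +-suc i (toℕ j) ⟩
      suc (i + toℕ j)               ≡⟨ cong (λ t → suc (i + t)) (toℕ-inject₁ j) ⟨
      suc (i + toℕ (inject₁ j))     ≡⟨ cong suc (lev (inject₁ j)) ⟨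
      suc (level (p (inject₁ j)))   ∎

    edge-ascends : ∀ j v → Label (p (inject₁ j)) (p (suc j)) v →
                   v ∉ tr (p (inject₁ j)) × v ∈ tr (p (suc j)) × tr (p (inject₁ j)) ⊆ tr (p (suc j))
    edge-ascends j v j-v = ascend (p (inject₁ j)) (p (suc j)) v j-v (rises j)

    traces-increase : ∀ a b → toℕ a ≤ toℕ b → tr (p a) ⊆ tr (p b)
    traces-increase = chain-mono {_∼_ = _⊆_} ⊆-refl ⊆-trans (tr ∘ p) edge-grows
      where
      edge-grows : ∀ j → tr (p (inject₁ j)) ⊆ tr (p (suc j))
      edge-grows j with size-one⇒singleton _ (adj j)
      ... | v , j-v = proj₂ (proj₂ (edge-ascends j v j-v))

    earlier-labels : ∀ (j : Fin (suc h)) (m : Fin h) → toℕ m < toℕ j → ∀ v →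
                     Label (p (inject₁ m)) (p (suc m)) v → v ∈ tr (p j)
    earlier-labels j m m<j v m-v =
      traces-increase (suc m) j m<j (proj₁ (proj₂ (edge-ascends m v m-v)))

    -- A later edge cannot carry the label of an earlier one: that label
    -- is already in the trace the later edge starts from.
    later-label-new : ∀ (j j′ : Fin h) → toℕ j < toℕ j′ → ∀ v →
                      Label (p (inject₁ j)) (p (suc j)) v →
                      ¬ Label (p (inject₁ j′)) (p (suc j′)) v
    later-label-new j j′ j<j′ v j-v j′-v =
      proj₁ (edge-ascends j′ v j′-v)
            (earlier-labels (inject₁ j′) j (subst (toℕ j <_) (sym (toℕ-inject₁ j′)) j<j′) v j-v)

    distinct-labels : ∀ (j j′ : Fin h) → j ≢ j′ → ∀ v →
                      Label (p (inject₁ j)) (p (suc j)) v →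
                      ¬ Label (p (inject₁ j′)) (p (suc j′)) v
    distinct-labels j j′ j≢j′ v with <-cmp (toℕ j) (toℕ j′)
    ... | tri< j<j′ _ _ = later-label-new j j′ j<j′ v
    ... | tri≈ _ j≡j′ _ = absurd (j≢j′ (toℕ-injective j≡j′))
    ... | tri> _ _ j′<j = flip (later-label-new j′ j j′<j v)

proposition3p2 :
    ∀ (n : ℕ) (G : Graph n) (S : Subset n) (k : ℕ) →
    Connected G → IsLD G S → ∣ S ∣ ≡ k →
    let open Assoc G S in
    -- 1. |V(G^S)| = n - k + 1
    (VS ↔ Fin (n ∸ k + 1))
    -- 2. G^S is bipartite
    × Bipartite
    -- 3. distinct edges sharing an endpoint have different labels
    × (∀ x y w → Adj x y → Adj x w → y ≢ w →
         ∀ v → Label x y v → ¬ Label x w v)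
    -- 4. every cycle x ∷ xs (x = last of xs, xs without repetition,
    --    at least 3 edges) has an even number of edges labeled v, for v ∈ S
    × (∀ x (xs : List VS) → Linked Adj (x ∷ xs) → 3 ≤ length xs →
         end x xs ≡ x → Unique xs →
         ∀ v → v ∈ S → 2 ∣ labCount v (steps x xs))
    -- 5. a walk with no repeated edge and an even number of edges of
    --    every label v ∈ S is closed
    × (∀ x (xs : List VS) → Linked Adj (x ∷ xs) →
         AllPairs (λ e f → ¬ SameEdge e f) (steps x xs) →
         (∀ v → v ∈ S → 2 ∣ labCount v (steps x xs)) →
         end x xs ≡ x)
    -- 6. a path p 0, …, p h with p j at level i + j
    × (∀ (i h : ℕ) (p : Fin (suc h) → VS) →
         (∀ (j : Fin h) → Adj (p (inject₁ j)) (p (suc j))) →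
         (∀ a b → p a ≡ p b → a ≡ b) →
         (∀ j → level (p j) ≡ i + toℕ j) →
         -- (a) pairwise different labels
         (∀ (j j′ : Fin h) → j ≢ j′ → ∀ v →
            Label (p (inject₁ j)) (p (suc j)) v →
            ¬ Label (p (inject₁ j′)) (p (suc j′)) v)
         -- (b) labels of earlier edges lie in N_G(x_j) ∩ S
         × (∀ (j : Fin (suc h)) (m : Fin h) → toℕ m < toℕ j → ∀ v →
            Label (p (inject₁ m)) (p (suc m)) v → v ∈ tr (p j)))
proposition3p2 n G S k _ ld refl =
    associated-order G S
  , bipartite
  , distinct-labels-at-vertex
  , (λ x xs walk _ closed _ v _ → closed-walk-even x xs walk closed v)
  , (λ x xs walk _ even → even-walk-closed x xs walk even)
  , λ i h p adj _ lev → let open AscendingPath i h p adj lev in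
      distinct-labels , earlier-labels
  where open LocatingDominating G S ld
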